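{- Let $(Y,\le_Y)$ be a nonempty partially ordered set. The following statements are equivalent. (i) $(Y,\le_Y)$ is a complete lattice. (ii) For every poset $(X,\le_X)$ and every $A\subseteq X$, every isotone map $f\colon A\to Y$ has a lower isotone extension. (iii) For every poset $(X,\le_X)$ and every $A\subseteq X$, every isotone map $f\colon A\to Y$ has an upper isotone extension. (iv) For every poset $(X,\le_X)$ and every $A\subseteq X$, every isotone map $f\colon A\to Y$ has an isotone extension.
   Context: A map $f\colon X\to Y$ between posets is isotone if $x\le_X y$ implies $f(x)\le_Y f(y)$. A subset $A\subseteq X$ carries the order induced from $X$. For $A\subseteq X$ and isotone $f\colon A\to Y$, an isotone extension of $f$ is an isotone map $\Psi\colon X\to Y$ with $\Psi(a)=f(a)$ for all $a\in A$. An isotone extension $\Psi$ of $f$ is called upper (resp. lower) if for every isotone extension $\chi\colon X\to Y$ of $f$ and every $x\in X$ one has $\chi(x)\le_Y\Psi(x)$ (resp. $\Psi(x)\le_Y\chi(x)$). A complete lattice is a poset in which every nonempty subset has both a supremum and an infimum. -}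

module Defs where

open import Level using (Level; _⊔_; suc)
open import Data.Product using (Σ; ∃; _×_; _,_; proj₁)
open import Relation.Unary using (Pred; _∈_)
open import Relation.Binary.Bundles using (Poset)

module _ {c ℓ₁ ℓ₂ p : Level} (X : Poset c ℓ₁ ℓ₂) (A : Pred (Poset.Carrier X) p) where
  open Poset X

  Sub : Set (c ⊔ p)
  Sub = Σ Carrier (λ x → x ∈ A)

  _≤ₐ_ : Sub → Sub → Set ℓ₂
  a ≤ₐ b = proj₁ a ≤ proj₁ b

module _ {c ℓ₁ ℓ₂ c' ℓ₁' ℓ₂' p : Level}
         (X : Poset c ℓ₁ ℓ₂) (A : Pred (Poset.Carrier X) p) (Y : Poset c' ℓ₁' ℓ₂') where
  private
    module X = Poset X
    module Y = Poset Y

  IsotoneOn : (Sub X A → Y.Carrier) → Set (c ⊔ p ⊔ ℓ₂ ⊔ ℓ₂')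
  IsotoneOn f = ∀ a b → _≤ₐ_ X A a b → f a Y.≤ f b

  Isotone : (X.Carrier → Y.Carrier) → Set (c ⊔ ℓ₂ ⊔ ℓ₂')
  Isotone g = ∀ x y → x X.≤ y → g x Y.≤ g y

  IsIsotoneExtension : (Sub X A → Y.Carrier) → (X.Carrier → Y.Carrier) → Set (c ⊔ p ⊔ ℓ₂ ⊔ ℓ₁' ⊔ ℓ₂')
  IsIsotoneExtension f Ψ = Isotone Ψ × (∀ (a : Sub X A) → Ψ (proj₁ a) Y.≈ f a)

  IsUpperIsotoneExtension : (Sub X A → Y.Carrier) → (X.Carrier → Y.Carrier) → Set _
  IsUpperIsotoneExtension f Ψ =
    IsIsotoneExtension f Ψ ×
    (∀ (χ : X.Carrier → Y.Carrier) → IsIsotoneExtension f χ → ∀ x → χ x Y.≤ Ψ x)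

  IsLowerIsotoneExtension : (Sub X A → Y.Carrier) → (X.Carrier → Y.Carrier) → Set _
  IsLowerIsotoneExtension f Ψ =
    IsIsotoneExtension f Ψ ×
    (∀ (χ : X.Carrier → Y.Carrier) → IsIsotoneExtension f χ → ∀ x → Ψ x Y.≤ χ x)

module _ {c ℓ₁ ℓ₂ : Level} (Y : Poset c ℓ₁ ℓ₂) where
  open Poset Y

  IsUpperBound : ∀ {s} → Pred Carrier s → Carrier → Set (c ⊔ s ⊔ ℓ₂)
  IsUpperBound S u = ∀ y → y ∈ S → y ≤ u

  IsLowerBound : ∀ {s} → Pred Carrier s → Carrier → Set (c ⊔ s ⊔ ℓ₂)
  IsLowerBound S l = ∀ y → y ∈ S → l ≤ y

  IsSupremum : ∀ {s} → Pred Carrier s → Carrier → Set _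
  IsSupremum S m = IsUpperBound S m × (∀ u → IsUpperBound S u → m ≤ u)

  IsInfimum : ∀ {s} → Pred Carrier s → Carrier → Set _
  IsInfimum S m = IsLowerBound S m × (∀ l → IsLowerBound S l → l ≤ m)

  IsCompleteLattice : (s : Level) → Set _
  IsCompleteLattice s =
    ∀ (S : Pred Carrier s) → (∃ λ y → y ∈ S) →
      (∃ λ m → IsSupremum S m) × (∃ λ m → IsInfimum S m)

module _ {ℓ : Level} (Y : Poset ℓ ℓ ℓ) where
  private module Y = Poset Y

  HasLowerExtensions : Set (suc ℓ)
  HasLowerExtensions =
    ∀ (X : Poset ℓ ℓ ℓ) (A : Pred (Poset.Carrier X) ℓ) (f : Sub X A → Y.Carrier) →
      IsotoneOn X A Y f → ∃ λ Ψ → IsLowerIsotoneExtension X A Y f Ψ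

  HasUpperExtensions : Set (suc ℓ)
  HasUpperExtensions =
    ∀ (X : Poset ℓ ℓ ℓ) (A : Pred (Poset.Carrier X) ℓ) (f : Sub X A → Y.Carrier) →
      IsotoneOn X A Y f → ∃ λ Ψ → IsUpperIsotoneExtension X A Y f Ψ

  HasExtensions : Set (suc ℓ)
  HasExtensions =
    ∀ (X : Poset ℓ ℓ ℓ) (A : Pred (Poset.Carrier X) ℓ) (f : Sub X A → Y.Carrier) →
      IsotoneOn X A Y f → ∃ λ Ψ → IsIsotoneExtension X A Y f Ψ

-- One direction builds the least extension pointwise: Ψ x is the supremum of the
-- values f a with a ≤ x (together with ⊥, so the set is nonempty); the greatest
-- extension is the same construction in the order duals of X and Y.  Conversely,
-- to find the supremum of S ⊆ Y, insert a new point between a copy of S and a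
-- copy of Y whose order places it exactly above S and below the upper bounds of S;
-- the value at that point of any isotone extension of the two inclusions is a
-- supremum of S.  Infima are suprema in the dual order.
module Submission where

open import Defs
open import Level using (Level)
open import Data.Product using (_×_; Σ; ∃; _,_; proj₁; proj₂; swap)
open import Data.Sum using (_⊎_; inj₁; inj₂)
open import Data.Unit.Polymorphic using (⊤; tt)
open import Data.Empty.Polymorphic using (⊥)
open import Function using (_∘_)
open import Function.Bundles using (_⇔_; mk⇔)
open import Relation.Unary using (Pred; _∈_)
open import Relation.Binary.Bundles using (Poset)
open import Relation.Binary.Properties.Poset using (≥-poset)

private
  variable
    ℓ : Level

module _ (Y : Poset ℓ ℓ ℓ) where
  open Poset Y

  lowerExtensions⇒extensions : HasLowerExtensions Y → HasExtensions Y
  lowerExtensions⇒extensions has X A f f-iso =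
    let Ψ , Ψ-ext , _ = has X A f f-iso in Ψ , Ψ-ext

  upperExtensions⇒extensions : HasUpperExtensions Y → HasExtensions Y
  upperExtensions⇒extensions has X A f f-iso =
    let Ψ , Ψ-ext , _ = has X A f f-iso in Ψ , Ψ-ext

  completeLattice-dual : IsCompleteLattice Y ℓ → IsCompleteLattice (≥-poset Y) ℓ
  completeLattice-dual cl S S-inhabited = swap (cl S S-inhabited)

  completeLattice⇒least : Carrier → IsCompleteLattice Y ℓ → ∃ λ ⊥Y → ∀ y → ⊥Y ≤ y
  completeLattice⇒least y₀ cl =
    let ⊥Y , ⊥Y-lower , _ = proj₂ (cl (λ _ → ⊤) (y₀ , tt)) in ⊥Y , λ y → ⊥Y-lower y tt

module _ (X : Poset ℓ ℓ ℓ) (A : Pred (Poset.Carrier X) ℓ) (Y : Poset ℓ ℓ ℓ)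
         (f : Sub X A → Poset.Carrier Y) where

  isotoneOn-dual : IsotoneOn X A Y f → IsotoneOn (≥-poset X) A (≥-poset Y) f
  isotoneOn-dual f-iso a b b≤a = f-iso b a b≤a

  isotoneExtension-dual : ∀ {Ψ} → IsIsotoneExtension X A Y f Ψ →
                          IsIsotoneExtension (≥-poset X) A (≥-poset Y) f Ψ
  isotoneExtension-dual (Ψ-iso , Ψ-ext) = (λ x y y≤x → Ψ-iso y x y≤x) , Ψ-ext

  lowerIsotoneExtension-dual : ∀ {Ψ} → IsLowerIsotoneExtension (≥-poset X) A (≥-poset Y) f Ψ →
                               IsUpperIsotoneExtension X A Y f Ψ
  lowerIsotoneExtension-dual ((Ψ-iso , Ψ-ext) , Ψ-least) =
    ((λ x y x≤y → Ψ-iso y x x≤y) , Ψ-ext) , λ χ χ-ext → Ψ-least χ (isotoneExtension-dual χ-ext)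

module _ (Y : Poset ℓ ℓ ℓ) where
  extensions-dual : HasExtensions Y → HasExtensions (≥-poset Y)
  extensions-dual has X A f f-iso =
    let Ψ , Ψ-ext = has (≥-poset X) A f (λ a b b≤a → f-iso b a b≤a)
    in Ψ , isotoneExtension-dual (≥-poset X) A Y f Ψ-ext

module _ (Y : Poset ℓ ℓ ℓ) (cl : IsCompleteLattice Y ℓ) (⊥Y : Poset.Carrier Y)
         (⊥Y-least : ∀ y → Poset._≤_ Y ⊥Y y)
         (X : Poset ℓ ℓ ℓ) (A : Pred (Poset.Carrier X) ℓ) (f : Sub X A → Poset.Carrier Y) where
  open Poset Y
  private module X = Poset X

  valuesBelow : X.Carrier → Pred Carrier ℓ
  valuesBelow x y = (Σ (Sub X A) λ a → proj₁ a X.≤ x × y ≈ f a) ⊎ y ≈ ⊥Y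

  leastExtension : X.Carrier → Carrier
  leastExtension x = proj₁ (proj₁ (cl (valuesBelow x) (⊥Y , inj₂ Eq.refl)))

  leastExtension-upper : ∀ x → IsUpperBound Y (valuesBelow x) (leastExtension x)
  leastExtension-upper x = proj₁ (proj₂ (proj₁ (cl (valuesBelow x) (⊥Y , inj₂ Eq.refl))))

  leastExtension-least : ∀ x u → IsUpperBound Y (valuesBelow x) u → leastExtension x ≤ u
  leastExtension-least x = proj₂ (proj₂ (proj₁ (cl (valuesBelow x) (⊥Y , inj₂ Eq.refl))))

  valuesBelow-bounded : ∀ x u → (∀ a → proj₁ a X.≤ x → f a ≤ u) →
                        IsUpperBound Y (valuesBelow x) u
  valuesBelow-bounded x u bound y (inj₁ (a , a≤x , y≈fa)) = trans (reflexive y≈fa) (bound a a≤x)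
  valuesBelow-bounded x u bound y (inj₂ y≈⊥) = trans (reflexive y≈⊥) (⊥Y-least u)

  leastExtension-isotone : Isotone X A Y leastExtension
  leastExtension-isotone x y x≤y =
    leastExtension-least x (leastExtension y) (valuesBelow-bounded x _ λ a a≤x →
      leastExtension-upper y (f a) (inj₁ (a , X.trans a≤x x≤y , Eq.refl)))

  leastExtension-below : ∀ χ → IsIsotoneExtension X A Y f χ → ∀ x → leastExtension x ≤ χ x
  leastExtension-below χ (χ-iso , χ-ext) x =
    leastExtension-least x (χ x) (valuesBelow-bounded x _ λ a a≤x →
      trans (reflexive (Eq.sym (χ-ext a))) (χ-iso _ _ a≤x))

  leastExtension-extends : IsotoneOn X A Y f → ∀ a → leastExtension (proj₁ a) ≈ f a
  leastExtension-extends f-iso a = antisym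
    (leastExtension-least (proj₁ a) (f a) (valuesBelow-bounded (proj₁ a) (f a) λ b → f-iso b a))
    (leastExtension-upper (proj₁ a) (f a) (inj₁ (a , X.refl , Eq.refl)))

  leastExtension-isLower : IsotoneOn X A Y f → IsLowerIsotoneExtension X A Y f leastExtension
  leastExtension-isLower f-iso =
    (leastExtension-isotone , leastExtension-extends f-iso) , leastExtension-below

completeLattice⇒lowerExtensions : (Y : Poset ℓ ℓ ℓ) → Poset.Carrier Y →
                                  IsCompleteLattice Y ℓ → HasLowerExtensions Y
completeLattice⇒lowerExtensions Y y₀ cl X A f f-iso =
  let ⊥Y , ⊥Y-least = completeLattice⇒least Y y₀ cl
  in leastExtension Y cl ⊥Y ⊥Y-least X A f , leastExtension-isLower Y cl ⊥Y ⊥Y-least X A f f-iso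

completeLattice⇒upperExtensions : (Y : Poset ℓ ℓ ℓ) → Poset.Carrier Y →
                                  IsCompleteLattice Y ℓ → HasUpperExtensions Y
completeLattice⇒upperExtensions Y y₀ cl X A f f-iso =
  let Ψ , Ψ-lower = completeLattice⇒lowerExtensions (≥-poset Y) y₀ (completeLattice-dual Y cl)
                      (≥-poset X) A f (isotoneOn-dual X A Y f f-iso)
  in Ψ , lowerIsotoneExtension-dual X A Y f Ψ-lower

module _ (Y : Poset ℓ ℓ ℓ) (S : Pred (Poset.Carrier Y) ℓ) where
  open Poset Y

  data Gapped : Set ℓ where
    below : Σ Carrier (_∈ S) → Gapped
    gap   : Gapped
    above : Carrier → Gapped

  data _≈ᵍ_ : Gapped → Gapped → Set ℓ where
    below≈ : ∀ {a b} → proj₁ a ≈ proj₁ b → below a ≈ᵍ below b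
    gap≈   : gap ≈ᵍ gap
    above≈ : ∀ {a b} → a ≈ b → above a ≈ᵍ above b

  data _≤ᵍ_ : Gapped → Gapped → Set ℓ where
    below≤below : ∀ {a b} → proj₁ a ≤ proj₁ b → below a ≤ᵍ below b
    below≤gap   : ∀ {a} → below a ≤ᵍ gap
    below≤above : ∀ {a b} → proj₁ a ≤ b → below a ≤ᵍ above b
    gap≤gap     : gap ≤ᵍ gap
    gap≤above   : ∀ {b} → IsUpperBound Y S b → gap ≤ᵍ above b
    above≤above : ∀ {a b} → a ≤ b → above a ≤ᵍ above b

  ≈ᵍ-refl : ∀ {x} → x ≈ᵍ x
  ≈ᵍ-refl {below a} = below≈ Eq.refl
  ≈ᵍ-refl {gap}     = gap≈
  ≈ᵍ-refl {above a} = above≈ Eq.refl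

  ≈ᵍ-sym : ∀ {x y} → x ≈ᵍ y → y ≈ᵍ x
  ≈ᵍ-sym (below≈ a≈b) = below≈ (Eq.sym a≈b)
  ≈ᵍ-sym gap≈         = gap≈
  ≈ᵍ-sym (above≈ a≈b) = above≈ (Eq.sym a≈b)

  ≈ᵍ-trans : ∀ {x y z} → x ≈ᵍ y → y ≈ᵍ z → x ≈ᵍ z
  ≈ᵍ-trans (below≈ p) (below≈ q) = below≈ (Eq.trans p q)
  ≈ᵍ-trans gap≈       gap≈       = gap≈
  ≈ᵍ-trans (above≈ p) (above≈ q) = above≈ (Eq.trans p q)

  ≤ᵍ-reflexive : ∀ {x y} → x ≈ᵍ y → x ≤ᵍ y
  ≤ᵍ-reflexive (below≈ a≈b) = below≤below (reflexive a≈b)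
  ≤ᵍ-reflexive gap≈         = gap≤gap
  ≤ᵍ-reflexive (above≈ a≈b) = above≤above (reflexive a≈b)

  ≤ᵍ-trans : ∀ {x y z} → x ≤ᵍ y → y ≤ᵍ z → x ≤ᵍ z
  ≤ᵍ-trans (below≤below p) (below≤below q) = below≤below (trans p q)
  ≤ᵍ-trans (below≤below p) below≤gap       = below≤gap
  ≤ᵍ-trans (below≤below p) (below≤above q) = below≤above (trans p q)
  ≤ᵍ-trans {below a} below≤gap (gap≤above b-upper) = below≤above (b-upper (proj₁ a) (proj₂ a))
  ≤ᵍ-trans below≤gap       gap≤gap         = below≤gap
  ≤ᵍ-trans (below≤above p) (above≤above q) = below≤above (trans p q)
  ≤ᵍ-trans gap≤gap         q               = q
  ≤ᵍ-trans (gap≤above b-upper) (above≤above b≤c) = gap≤above λ y y∈S → trans (b-upper y y∈S) b≤c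
  ≤ᵍ-trans (above≤above p) (above≤above q) = above≤above (trans p q)

  ≤ᵍ-antisym : ∀ {x y} → x ≤ᵍ y → y ≤ᵍ x → x ≈ᵍ y
  ≤ᵍ-antisym (below≤below p) (below≤below q) = below≈ (antisym p q)
  ≤ᵍ-antisym gap≤gap         _               = gap≈
  ≤ᵍ-antisym (above≤above p) (above≤above q) = above≈ (antisym p q)

  gapped : Poset ℓ ℓ ℓ
  gapped = record
    { Carrier = Gapped ; _≈_ = _≈ᵍ_ ; _≤_ = _≤ᵍ_
    ; isPartialOrder = record
      { isPreorder = record
        { isEquivalence = record { refl = ≈ᵍ-refl ; sym = ≈ᵍ-sym ; trans = ≈ᵍ-trans }
        ; reflexive = ≤ᵍ-reflexive
        ; trans = ≤ᵍ-trans }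
      ; antisym = ≤ᵍ-antisym } }

  outsideGap : Pred Gapped ℓ
  outsideGap (below _) = ⊤
  outsideGap gap       = ⊥
  outsideGap (above _) = ⊤

  inclusion : Sub gapped outsideGap → Carrier
  inclusion (below a , _) = proj₁ a
  inclusion (above b , _) = b

  inclusion-isotone : IsotoneOn gapped outsideGap Y inclusion
  inclusion-isotone (below _ , _) (below _ , _) (below≤below p) = p
  inclusion-isotone (below _ , _) (above _ , _) (below≤above p) = p
  inclusion-isotone (above _ , _) (above _ , _) (above≤above p) = p

  extensions⇒supremum : HasExtensions Y → ∃ λ m → IsSupremum Y S m
  extensions⇒supremum has =
    let Ψ , Ψ-iso , Ψ-ext = has gapped outsideGap inclusion inclusion-isotone
    in Ψ gap
     , (λ s s∈S → trans (reflexive (Eq.sym (Ψ-ext (below (s , s∈S) , tt))))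
                        (Ψ-iso (below (s , s∈S)) gap below≤gap))
     , (λ u u-upper → trans (Ψ-iso gap (above u) (gap≤above u-upper))
                            (reflexive (Ψ-ext (above u , tt))))

extensions⇒completeLattice : (Y : Poset ℓ ℓ ℓ) → HasExtensions Y → IsCompleteLattice Y ℓ
extensions⇒completeLattice Y has S _ =
  extensions⇒supremum Y S has , extensions⇒supremum (≥-poset Y) S (extensions-dual Y has)

theorem2p6 : ∀ {ℓ : Level} (Y : Poset ℓ ℓ ℓ) → Poset.Carrier Y →
    (IsCompleteLattice Y ℓ ⇔ HasLowerExtensions Y) ×
    (IsCompleteLattice Y ℓ ⇔ HasUpperExtensions Y) ×
    (IsCompleteLattice Y ℓ ⇔ HasExtensions Y)
theorem2p6 Y y₀ =
  mk⇔ (completeLattice⇒lowerExtensions Y y₀)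
      (extensions⇒completeLattice Y ∘ lowerExtensions⇒extensions Y) ,
  mk⇔ (completeLattice⇒upperExtensions Y y₀)
      (extensions⇒completeLattice Y ∘ upperExtensions⇒extensions Y) ,
  mk⇔ (lowerExtensions⇒extensions Y ∘ completeLattice⇒lowerExtensions Y y₀)
      (extensions⇒completeLattice Y)
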